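{- Let $\mathsf{Var}$ be a set and let all notation be as in the context. For every $A \in \mathsf{Tm}$, every $N \in \mathsf{Nf}$ and every map expression $f : A \Rightarrow \mathsf{emb}\,N$, we have $\mathsf{nf}\,A = N$, and (so that $\mathsf{nm}\,A$ is a map expression $A \Rightarrow \mathsf{emb}\,N$) $\mathsf{nm}\,A \doteq f$. In particular, any two map expressions $f, g : A \Rightarrow \mathsf{emb}\,N$ satisfy $f \doteq g$.
   Context: Fix a set $\mathsf{Var}$. Object expressions $\mathsf{Tm}$: for $X \in \mathsf{Var}$, $\mathsf{v}\,X \in \mathsf{Tm}$; $\mathsf{I} \in \mathsf{Tm}$; if $A,B\in\mathsf{Tm}$ then $A\otimes B \in \mathsf{Tm}$. For $A,B \in \mathsf{Tm}$, map expressions $A \Rightarrow B$ are generated by: $\mathsf{id} : A \Rightarrow A$; $f \circ g : A \Rightarrow C$ for $f : B \Rightarrow C$, $g : A \Rightarrow B$; $f \otimes g : A\otimes B \Rightarrow C \otimes D$ for $f : A \Rightarrow C$, $g : B \Rightarrow D$; $\lambda : \mathsf{I}\otimes A \Rightarrow A$; $\rho : A \Rightarrow A \otimes \mathsf{I}$; $\alpha : (A\otimes B)\otimes C \Rightarrow A\otimes(B\otimes C)$. The relation $\doteq$ between map expressions of the same type is the smallest relation closed under: reflexivity, symmetry, transitivity; if $f \doteq g$ and $h \doteq k$ then $f\circ h \doteq g \circ k$ and $f \otimes h \doteq g\otimes k$; $\mathsf{id}\circ f \doteq f$; $f \doteq f\circ \mathsf{id}$; $(f\circ g)\circ h \doteq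 f\circ(g\circ h)$; $\mathsf{id}\otimes\mathsf{id} \doteq \mathsf{id}$; $(h\circ f)\otimes(k\circ g) \doteq (h\otimes k)\circ(f\otimes g)$; $\lambda\circ(\mathsf{id}\otimes f) \doteq f\circ\lambda$; $\rho\circ f \doteq (f\otimes\mathsf{id})\circ\rho$; $\alpha\circ((f\otimes g)\otimes h) \doteq (f\otimes(g\otimes h))\circ\alpha$; $\lambda\circ\rho \doteq \mathsf{id}$ (on $\mathsf{I}$); $\mathsf{id} \doteq (\mathsf{id}\otimes\lambda)\circ\alpha\circ(\rho\otimes\mathsf{id})$ (on $A \otimes B$); $\lambda\circ\alpha \doteq \lambda\otimes\mathsf{id}$; $\alpha\circ\rho \doteq \mathsf{id}\otimes\rho$; $\alpha\circ\alpha \doteq (\mathsf{id}\otimes\alpha)\circ\alpha\circ(\alpha\otimes\mathsf{id})$ (all instances well-typed). (Thus $\mathsf{Tm}$ with map expressions modulo $\doteq$ is the free left skew-monoidal category on $\mathsf{Var}$.) Normal forms $\mathsf{Nf}$: $\mathsf{J}\in\mathsf{Nf}$; $X \mathbin{`\otimes} N \in \mathsf{Nf}$ for $X\in\mathsf{Var}$, $N\in\mathsf{Nf}$. $\mathsf{emb}\,\mathsf{J} = \mathsf{I}$, $\mathsf{emb}(X \mathbin{`\otimes} N) = \mathsf{v}\,X\otimes\mathsf{emb}\,N$. $\mathsf{nf}'_{\mathsf{v}X}\,N = X \mathbin{`\otimes} N$, $\mathsf{nf}'_{\mathsf{I}}\,N = N$, $\mathsf{nf}'_{A\otimes B}\,N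 = \mathsf{nf}'_A(\mathsf{nf}'_B\,N)$; $\mathsf{nf}\,A = \mathsf{nf}'_A\,\mathsf{J}$. The map expressions $\mathsf{nm}'_A\,N : A\otimes\mathsf{emb}\,N \Rightarrow \mathsf{emb}(\mathsf{nf}'_A\,N)$ are defined recursively on $A$ by $\mathsf{nm}'_{\mathsf{v}X}\,N = \mathsf{id}$, $\mathsf{nm}'_{\mathsf{I}}\,N = \lambda$, $\mathsf{nm}'_{A\otimes B}\,N = \mathsf{nm}'_A(\mathsf{nf}'_B\,N)\circ(\mathsf{id}\otimes\mathsf{nm}'_B\,N)\circ\alpha$; and $\mathsf{nm}\,A : A \Rightarrow \mathsf{emb}(\mathsf{nf}\,A)$ is $\mathsf{nm}\,A = \mathsf{nm}'_A\,\mathsf{J}\circ\rho$. -}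

module Defs where

open import Relation.Binary.PropositionalEquality using (_≡_; subst)

module _ (Var : Set) where

  infixl 20 _⊗_
  data Tm : Set where
    v   : Var → Tm
    I   : Tm
    _⊗_ : Tm → Tm → Tm

  infix 15 _⇒_
  infixr 20 _∘_
  infixl 21 _⊗m_
  data _⇒_ : Tm → Tm → Set where
    id  : {A : Tm} → A ⇒ A
    _∘_ : {A B C : Tm} → B ⇒ C → A ⇒ B → A ⇒ C
    _⊗m_ : {A B C D : Tm} → A ⇒ C → B ⇒ D → A ⊗ B ⇒ C ⊗ D
    λ'  : {A : Tm} → I ⊗ A ⇒ A
    ρ   : {A : Tm} → A ⇒ A ⊗ I
    α   : {A B C : Tm} → (A ⊗ B) ⊗ C ⇒ A ⊗ (B ⊗ C)

  infix 10 _≐_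
  data _≐_ : {A B : Tm} → A ⇒ B → A ⇒ B → Set where
    refl≐  : {A B : Tm} {f : A ⇒ B} → f ≐ f
    sym≐   : {A B : Tm} {f g : A ⇒ B} → f ≐ g → g ≐ f
    _∙_    : {A B : Tm} {f g h : A ⇒ B} → f ≐ g → g ≐ h → f ≐ h
    _∘≐_   : {A B C : Tm} {f g : B ⇒ C} {h k : A ⇒ B} → f ≐ g → h ≐ k → f ∘ h ≐ g ∘ k
    _⊗≐_   : {A B C D : Tm} {f g : A ⇒ C} {h k : B ⇒ D} → f ≐ g → h ≐ k → f ⊗m h ≐ g ⊗m k
    lid    : {A B : Tm} {f : A ⇒ B} → id ∘ f ≐ f
    rid    : {A B : Tm} {f : A ⇒ B} → f ≐ f ∘ id
    ass    : {A B C D : Tm} {f : C ⇒ D} {g : B ⇒ C} {h : A ⇒ B} → (f ∘ g) ∘ h ≐ f ∘ (g ∘ h)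
    f⊗id   : {A B : Tm} → id {A} ⊗m id {B} ≐ id
    f⊗∘    : {A B C D E F : Tm} {f : A ⇒ C} {g : B ⇒ D} {h : C ⇒ E} {k : D ⇒ F}
             → (h ∘ f) ⊗m (k ∘ g) ≐ (h ⊗m k) ∘ (f ⊗m g)
    nλ     : {A B : Tm} {f : A ⇒ B} → λ' ∘ (id ⊗m f) ≐ f ∘ λ'
    nρ     : {A B : Tm} {f : A ⇒ B} → ρ ∘ f ≐ (f ⊗m id) ∘ ρ
    nα     : {A B C D E F : Tm} {f : A ⇒ D} {g : B ⇒ E} {h : C ⇒ F}
             → α ∘ ((f ⊗m g) ⊗m h) ≐ (f ⊗m (g ⊗m h)) ∘ α
    lρ     : λ' ∘ ρ ≐ id {I}
    lαρ    : {A B : Tm} → id {A ⊗ B} ≐ (id ⊗m λ') ∘ α ∘ (ρ ⊗m id)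
    lα     : {A B : Tm} → λ' ∘ α {I} {A} {B} ≐ λ' ⊗m id
    αρ     : {A B : Tm} → α {A} {B} {I} ∘ ρ ≐ id ⊗m ρ
    pent   : {A B C D : Tm} → α {A} {B} {C ⊗ D} ∘ α ≐ (id ⊗m α) ∘ α ∘ (α ⊗m id)

  data Nf : Set where
    J    : Nf
    _`⊗_ : Var → Nf → Nf

  emb : Nf → Tm
  emb J = I
  emb (X `⊗ N) = v X ⊗ emb N

  nf' : Tm → Nf → Nf
  nf' (v X) N = X `⊗ N
  nf' I N = N
  nf' (A ⊗ B) N = nf' A (nf' B N)

  nf : Tm → Nf
  nf A = nf' A J

  nm' : (A : Tm) (N : Nf) → A ⊗ emb N ⇒ emb (nf' A N)
  nm' (v X) N = id
  nm' I N = λ'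
  nm' (A ⊗ B) N = nm' A (nf' B N) ∘ (id ⊗m nm' B N) ∘ α

  nm : (A : Tm) → A ⇒ emb (nf A)
  nm A = nm' A J ∘ ρ

module Submission where

-- The proof is the normalisation-by-naturality argument.  We compare maps
-- into possibly different normal-form objects by a relation _≋_ (the normal
-- forms agree and then the maps are ≐-equal) and show:
--   * nm′ is natural in its first argument: nm′ B N ∘ (f ⊗ id) ≋ nm′ A N for
--     every f : A ⇒ B, by induction on f; each generator is one of the
--     skew-monoidal axioms, composition and tensor use the induction
--     hypotheses (for the tensor also in the shifted normal form);
--   * hence nm is natural: nm B ∘ f ≋ nm A;
--   * nm on an embedded normal form is (≋) the identity.
-- For f : A ⇒ emb N these give nm A ≋ nm (emb N) ∘ f ≋ f, whose first
-- component is nf A ≡ N; comparing two such maps through nm A gives f ≐ g.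

open import Defs
open import Data.Product using (Σ; _×_; _,_)
open import Level using (0ℓ)
open import Relation.Binary.Bundles using (Setoid)
open import Relation.Binary.PropositionalEquality using (_≡_; refl; subst)
import Relation.Binary.Reasoning.Setoid as SetoidReasoning

module Coherence (Var : Set) where

  T : Set
  T = Tm Var

  NF : Set
  NF = Nf Var

  infix 15 _⟶_
  _⟶_ : T → T → Set
  _⟶_ = _⇒_ Var

  infix 10 _≈_
  _≈_ : {A B : T} → A ⟶ B → A ⟶ B → Set
  _≈_ = _≐_ Var

  ⌜_⌝ : NF → T
  ⌜_⌝ = emb Var

  nf′ : T → NF → NF
  nf′ = nf' Var

  nm′ : (A : T) (N : NF) → A ⊗ ⌜ N ⌝ ⟶ ⌜ nf′ A N ⌝
  nm′ = nm' Var

  homSetoid : T → T → Setoid 0ℓ 0ℓ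
  homSetoid A B = record
    { Carrier       = A ⟶ B
    ; _≈_           = _≈_
    ; isEquivalence = record { refl = refl≐ ; sym = sym≐ ; trans = _∙_ }
    }

  module ≈-Reasoning {A B : T} = SetoidReasoning (homSetoid A B)

  ∘-congˡ : {A B C : T} {h : B ⟶ C} {f g : A ⟶ B} → f ≈ g → h ∘ f ≈ h ∘ g
  ∘-congˡ p = refl≐ ∘≐ p

  ∘-congʳ : {A B C : T} {h : A ⟶ B} {f g : B ⟶ C} → f ≈ g → f ∘ h ≈ g ∘ h
  ∘-congʳ p = p ∘≐ refl≐

  id⊗-∘ : {A B C D : T} {f : C ⟶ D} {g : B ⟶ C}
        → id {A = A} ⊗m (f ∘ g) ≈ (id ⊗m f) ∘ (id ⊗m g)
  id⊗-∘ = (sym≐ lid ⊗≐ refl≐) ∙ f⊗∘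

  ⊗-slide : {A B C D E : T} {f : A ⟶ C} {k : B ⟶ D} {h : D ⟶ E}
          → (id ⊗m h) ∘ (f ⊗m k) ≈ (f ⊗m id) ∘ (id ⊗m (h ∘ k))
  ⊗-slide {f = f} {k} {h} = begin
    (id ⊗m h) ∘ (f ⊗m k)        ≈⟨ f⊗∘ ⟨
    (id ∘ f) ⊗m (h ∘ k)         ≈⟨ (lid ∙ rid) ⊗≐ sym≐ lid ⟩
    (f ∘ id) ⊗m (id ∘ (h ∘ k))  ≈⟨ f⊗∘ ⟩
    (f ⊗m id) ∘ (id ⊗m (h ∘ k)) ∎
    where open ≈-Reasoning

  α-natural₃ : {A B C D : T} {h : C ⟶ D}
             → (id {A = A} ⊗m (id {A = B} ⊗m h)) ∘ α ≈ α ∘ (id ⊗m h)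
  α-natural₃ = sym≐ nα ∙ ∘-congˡ (f⊗id ⊗≐ refl≐)

  infix 10 _≋_
  _≋_ : {X : T} {M N : NF} → X ⟶ ⌜ M ⌝ → X ⟶ ⌜ N ⌝ → Set
  _≋_ {X} {M} {N} f g = Σ (M ≡ N) λ eq → subst (λ K → X ⟶ ⌜ K ⌝) eq f ≈ g

  ≈⇒≋ : {X : T} {M : NF} {f g : X ⟶ ⌜ M ⌝} → f ≈ g → f ≋ g
  ≈⇒≋ p = refl , p

  ≋⇒≈ : {X : T} {M : NF} {f g : X ⟶ ⌜ M ⌝} → f ≋ g → f ≈ g
  ≋⇒≈ (refl , p) = p

  ≋-sym : {X : T} {M N : NF} {f : X ⟶ ⌜ M ⌝} {g : X ⟶ ⌜ N ⌝} → f ≋ g → g ≋ f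
  ≋-sym (refl , p) = refl , sym≐ p

  ≋-trans : {X : T} {M N K : NF} {f : X ⟶ ⌜ M ⌝} {g : X ⟶ ⌜ N ⌝} {h : X ⟶ ⌜ K ⌝}
          → f ≋ g → g ≋ h → f ≋ h
  ≋-trans (refl , p) (refl , q) = refl , (p ∙ q)

  ≋-cong : {X Y : T} (G : NF → NF) (F : {M : NF} → X ⟶ ⌜ M ⌝ → Y ⟶ ⌜ G M ⌝)
         → ({M : NF} {f g : X ⟶ ⌜ M ⌝} → f ≈ g → F f ≈ F g)
         → {M N : NF} {f : X ⟶ ⌜ M ⌝} {g : X ⟶ ⌜ N ⌝} → f ≋ g → F f ≋ F g
  ≋-cong G F F-resp (refl , p) = refl , F-resp p

  module ≋-Reasoning where
    infix  1 begin_
    infixr 2 _≈⟨_⟩_ _≋⟨_⟩_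
    infix  3 _∎

    begin_ : {X : T} {M N : NF} {f : X ⟶ ⌜ M ⌝} {g : X ⟶ ⌜ N ⌝} → f ≋ g → f ≋ g
    begin p = p

    _≈⟨_⟩_ : {X : T} {M N : NF} (f : X ⟶ ⌜ M ⌝) {g : X ⟶ ⌜ M ⌝} {h : X ⟶ ⌜ N ⌝}
           → f ≈ g → g ≋ h → f ≋ h
    f ≈⟨ p ⟩ q = ≋-trans (≈⇒≋ p) q

    _≋⟨_⟩_ : {X : T} {M N K : NF} (f : X ⟶ ⌜ M ⌝) {g : X ⟶ ⌜ N ⌝} {h : X ⟶ ⌜ K ⌝}
           → f ≋ g → g ≋ h → f ≋ h
    f ≋⟨ p ⟩ q = ≋-trans p q

    _∎ : {X : T} {M : NF} (f : X ⟶ ⌜ M ⌝) → f ≋ f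
    f ∎ = ≈⇒≋ refl≐

  -- The structural maps id, λ, ρ, α do not change the normal form, so these
  -- cases are plain ≐-equations, each an instance of a skew-monoidal axiom.
  nm′-id : {A : T} (N : NF) → nm′ A N ∘ (id ⊗m id) ≈ nm′ A N
  nm′-id N = ∘-congˡ f⊗id ∙ sym≐ rid

  nm′-λ : {A : T} (N : NF) → nm′ A N ∘ (λ' ⊗m id) ≈ nm′ (I ⊗ A) N
  nm′-λ {A} N = begin
    nm′ A N ∘ (λ' ⊗m id)           ≈⟨ ∘-congˡ lα ⟨
    nm′ A N ∘ (λ' ∘ α)             ≈⟨ ass ⟨
    (nm′ A N ∘ λ') ∘ α             ≈⟨ ∘-congʳ nλ ⟨
    (λ' ∘ (id ⊗m nm′ A N)) ∘ α     ≈⟨ ass ⟩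
    λ' ∘ (id ⊗m nm′ A N) ∘ α       ∎
    where open ≈-Reasoning

  nm′-ρ : {A : T} (N : NF) → nm′ (A ⊗ I) N ∘ (ρ ⊗m id) ≈ nm′ A N
  nm′-ρ {A} N = begin
    (nm′ A N ∘ (id ⊗m λ') ∘ α) ∘ (ρ ⊗m id)  ≈⟨ ass ⟩
    nm′ A N ∘ ((id ⊗m λ') ∘ α) ∘ (ρ ⊗m id)  ≈⟨ ∘-congˡ ass ⟩
    nm′ A N ∘ (id ⊗m λ') ∘ α ∘ (ρ ⊗m id)    ≈⟨ ∘-congˡ lαρ ⟨
    nm′ A N ∘ id                             ≈⟨ rid ⟨
    nm′ A N                                  ∎
    where open ≈-Reasoning

  -- The associator case is the pentagon axiom together with naturality of α.
  nm′-α : {A B C : T} (N : NF)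
        → nm′ (A ⊗ (B ⊗ C)) N ∘ (α ⊗m id) ≈ nm′ ((A ⊗ B) ⊗ C) N
  nm′-α {A} {B} {C} N = begin
    (a ∘ (id ⊗m (b ∘ (id ⊗m c) ∘ α)) ∘ α) ∘ (α ⊗m id)
      ≈⟨ ass ∙ ∘-congˡ ass ⟩
    a ∘ (id ⊗m (b ∘ (id ⊗m c) ∘ α)) ∘ α ∘ (α ⊗m id)
      ≈⟨ ∘-congˡ (∘-congʳ (id⊗-∘ ∙ ∘-congˡ id⊗-∘)) ⟩
    a ∘ ((id ⊗m b) ∘ (id ⊗m (id ⊗m c)) ∘ (id ⊗m α)) ∘ α ∘ (α ⊗m id)
      ≈⟨ ∘-congˡ (ass ∙ ∘-congˡ ass) ⟩
    a ∘ (id ⊗m b) ∘ (id ⊗m (id ⊗m c)) ∘ (id ⊗m α) ∘ α ∘ (α ⊗m id)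
      ≈⟨ ∘-congˡ (∘-congˡ (∘-congˡ pent)) ⟨
    a ∘ (id ⊗m b) ∘ (id ⊗m (id ⊗m c)) ∘ α ∘ α
      ≈⟨ ∘-congˡ (∘-congˡ (sym≐ ass ∙ (∘-congʳ α-natural₃ ∙ ass))) ⟩
    a ∘ (id ⊗m b) ∘ α ∘ (id ⊗m c) ∘ α
      ≈⟨ ass ∙ ∘-congˡ ass ⟨
    (a ∘ (id ⊗m b) ∘ α) ∘ (id ⊗m c) ∘ α
      ∎
    where
    open ≈-Reasoning
    a = nm′ A (nf′ B (nf′ C N))
    b = nm′ B (nf′ C N)
    c = nm′ C N

  -- The tensor case: slide f ⊗ g through the associator, then apply the
  -- hypothesis for g (changing the inner normal form) and the hypothesis for
  -- f at the shifted normal form nf′ B N.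
  nm′-⊗ : {A B C D : T} (f : A ⟶ C) (g : B ⟶ D) (N : NF)
        → ((M : NF) → nm′ C M ∘ (f ⊗m id) ≋ nm′ A M)
        → nm′ D N ∘ (g ⊗m id) ≋ nm′ B N
        → nm′ (C ⊗ D) N ∘ ((f ⊗m g) ⊗m id) ≋ nm′ (A ⊗ B) N
  nm′-⊗ {A} {B} {C} {D} f g N f-nat g-nat = begin
    (nm′ C (nf′ D N) ∘ (id ⊗m nm′ D N) ∘ α) ∘ ((f ⊗m g) ⊗m id)
      ≈⟨ ass ∙ ∘-congˡ (ass ∙ ∘-congˡ nα) ⟩
    nm′ C (nf′ D N) ∘ (id ⊗m nm′ D N) ∘ (f ⊗m (g ⊗m id)) ∘ α
      ≈⟨ ∘-congˡ (sym≐ ass ∙ (∘-congʳ ⊗-slide ∙ ass)) ⟩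
    nm′ C (nf′ D N) ∘ (f ⊗m id) ∘ (id ⊗m (nm′ D N ∘ (g ⊗m id))) ∘ α
      ≋⟨ ≋-cong (nf′ C) (λ {M} h → nm′ C M ∘ (f ⊗m id) ∘ (id ⊗m h) ∘ α)
                (λ p → ∘-congˡ (∘-congˡ (∘-congʳ (refl≐ ⊗≐ p)))) g-nat ⟩
    nm′ C (nf′ B N) ∘ (f ⊗m id) ∘ (id ⊗m nm′ B N) ∘ α
      ≈⟨ sym≐ ass ⟩
    (nm′ C (nf′ B N) ∘ (f ⊗m id)) ∘ (id ⊗m nm′ B N) ∘ α
      ≋⟨ ≋-cong (λ M → M) (λ h → h ∘ (id ⊗m nm′ B N) ∘ α) ∘-congʳ (f-nat (nf′ B N)) ⟩
    nm′ A (nf′ B N) ∘ (id ⊗m nm′ B N) ∘ α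
      ∎
    where open ≋-Reasoning

  nm′-natural : {A B : T} (f : A ⟶ B) (N : NF) → nm′ B N ∘ (f ⊗m id) ≋ nm′ A N
  nm′-natural id N = ≈⇒≋ (nm′-id N)
  nm′-natural {A} {C} (_∘_ {B = B} f g) N = begin
    nm′ C N ∘ ((f ∘ g) ⊗m id)         ≈⟨ ∘-congˡ ((refl≐ ⊗≐ sym≐ lid) ∙ f⊗∘) ∙ sym≐ ass ⟩
    (nm′ C N ∘ (f ⊗m id)) ∘ (g ⊗m id) ≋⟨ ≋-cong (λ M → M) (_∘ (g ⊗m id)) ∘-congʳ (nm′-natural f N) ⟩
    nm′ B N ∘ (g ⊗m id)               ≋⟨ nm′-natural g N ⟩
    nm′ A N                           ∎
    where open ≋-Reasoning
  nm′-natural (f ⊗m g) N = nm′-⊗ f g N (nm′-natural f) (nm′-natural g N)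
  nm′-natural λ' N = ≈⇒≋ (nm′-λ N)
  nm′-natural ρ N = ≈⇒≋ (nm′-ρ N)
  nm′-natural α N = ≈⇒≋ (nm′-α N)

  nm-natural : {A B : T} (f : A ⟶ B) → nm Var B ∘ f ≋ nm Var A
  nm-natural {A} {B} f = begin
    (nm′ B J ∘ ρ) ∘ f             ≈⟨ ass ∙ (∘-congˡ nρ ∙ sym≐ ass) ⟩
    (nm′ B J ∘ (f ⊗m id)) ∘ ρ     ≋⟨ ≋-cong (λ M → M) (_∘ ρ) ∘-congʳ (nm′-natural f J) ⟩
    nm′ A J ∘ ρ                   ∎
    where open ≋-Reasoning

  nm-emb : (N : NF) → nm Var ⌜ N ⌝ ≋ id {A = ⌜ N ⌝}
  nm-emb J = ≈⇒≋ lρ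
  nm-emb (X `⊗ N) = begin
    (id ∘ (id ⊗m nm′ ⌜ N ⌝ J) ∘ α) ∘ ρ   ≈⟨ ∘-congʳ lid ∙ ass ⟩
    (id ⊗m nm′ ⌜ N ⌝ J) ∘ α ∘ ρ          ≈⟨ ∘-congˡ αρ ∙ sym≐ id⊗-∘ ⟩
    id ⊗m nm Var ⌜ N ⌝                    ≋⟨ ≋-cong (X `⊗_) (id ⊗m_) (refl≐ ⊗≐_) (nm-emb N) ⟩
    id ⊗m id                              ≈⟨ f⊗id ⟩
    id                                    ∎
    where open ≋-Reasoning

  nm-unique : (A : T) (N : NF) (f : A ⟶ ⌜ N ⌝) → nm Var A ≋ f
  nm-unique A N f = begin
    nm Var A          ≋⟨ ≋-sym (nm-natural f) ⟩
    nm Var ⌜ N ⌝ ∘ f  ≋⟨ ≋-cong (λ M → M) (_∘ f) ∘-congʳ (nm-emb N) ⟩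
    id ∘ f            ≈⟨ lid ⟩
    f                 ∎
    where open ≋-Reasoning

  coherence : (A : T) (N : NF) (f g : A ⟶ ⌜ N ⌝) → f ≈ g
  coherence A N f g = ≋⇒≈ (≋-trans (≋-sym (nm-unique A N f)) (nm-unique A N g))

proposition6 : (Var : Set)
    → ((A : Tm Var) (N : Nf Var) (f : _⇒_ Var A (emb Var N))
        → Σ (nf Var A ≡ N) (λ eq → _≐_ Var (subst (λ M → _⇒_ Var A (emb Var M)) eq (nm Var A)) f))
    × ((A : Tm Var) (N : Nf Var) (f g : _⇒_ Var A (emb Var N)) → _≐_ Var f g)
proposition6 Var = nm-unique , coherence
  where open Coherence Var
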